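{- A connected graph $G$ with no isolated vertices is $\gamma_{tR}$-ER-supercritical if and only if $G$ is either a non-trivial star $K_{1,n}$ ($n\geq 1$), or a double star in which each of the two non-pendant vertices has degree at least $3$.
   Context: All graphs are finite and simple. A double star is a tree obtained from two disjoint non-trivial stars by joining their central vertices by an edge (choosing either vertex as centre in the case of $K_2$). A total Roman dominating function (TRD-function) on a graph $G$ with no isolated vertices is a function $f:V(G)\to\{0,1,2\}$ such that every vertex $v$ with $f(v)=0$ is adjacent to some $u$ with $f(u)=2$, and the subgraph induced by $\{w:f(w)>0\}$ has no isolated vertices; its weight is $\sum_v f(v)$ and $\gamma_{tR}(G)$ is the minimum weight. For an edge $e$ incident with a vertex of degree $1$, define $\gamma_{tR}(G-e)=\infty$. A graph $G$ with no isolated vertices is $\gamma_{tR}$-ER-supercritical if $\gamma_{tR}(G-e)\geq\gamma_{tR}(G)+2$ for every edge $e\in E(G)$. -}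

module Defs where

open import Data.Nat using (ℕ; zero; suc; _+_; _≤_; _<_)
open import Data.Fin using (Fin; toℕ)
open import Data.Fin.Properties using (_≟_)
open import Data.Bool using (Bool; true; false; _∧_; _∨_; not)
open import Data.List using (List; length; filterᵇ; map)
open import Data.Nat.ListAction using (sum)
open import Data.List using () renaming (allFin to allFinL)
open import Data.Product using (Σ; _×_; ∃; ∃-syntax; _,_)
open import Data.Sum using (_⊎_)
open import Relation.Nullary using (¬_; does)
open import Relation.Binary.PropositionalEquality using (_≡_; _≢_)
open import Relation.Binary.Construct.Closure.ReflexiveTransitive using (Star)

Adj : ℕ → Set
Adj n = Fin n → Fin n → Bool

record Graph (n : ℕ) : Set where
  field
    adj   : Adj n
    sym   : ∀ u v → adj u v ≡ adj v u
    irrefl : ∀ v → adj v v ≡ false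
open Graph public

_==_ : ∀ {n} → Fin n → Fin n → Bool
x == y = does (x ≟ y)

deleteEdge : ∀ {n} → Adj n → Fin n → Fin n → Adj n
deleteEdge a u v x y = a x y ∧ not (((x == u) ∧ (y == v)) ∨ ((x == v) ∧ (y == u)))

deg : ∀ {n} → Adj n → Fin n → ℕ
deg {n} a v = length (filterᵇ (a v) (allFinL n))

NoIsolated : ∀ {n} → Adj n → Set
NoIsolated {n} a = ∀ (v : Fin n) → ∃[ u ] a v u ≡ true

Connected : ∀ {n} → Adj n → Set
Connected {n} a = ∀ (u v : Fin n) → Star (λ x y → a x y ≡ true) u v

Labelling : ℕ → Set
Labelling n = Fin n → Fin 3

weight : ∀ {n} → Labelling n → ℕ
weight {n} f = sum (map (λ v → toℕ (f v)) (allFinL n))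

IsTRDF : ∀ {n} → Adj n → Labelling n → Set
IsTRDF {n} a f =
  (∀ (v : Fin n) → toℕ (f v) ≡ 0 → ∃[ u ] (a v u ≡ true × toℕ (f u) ≡ 2)) ×
  (∀ (v : Fin n) → toℕ (f v) ≢ 0 → ∃[ u ] (a v u ≡ true × toℕ (f u) ≢ 0))

IsGammaTR : ∀ {n} → Adj n → ℕ → Set
IsGammaTR a k =
  (∃[ f ] (IsTRDF a f × weight f ≡ k)) × (∀ f → IsTRDF a f → k ≤ weight f)

-- γ_tR-ER-supercritical: for every edge e = uv, γ_tR(G - e) ≥ γ_tR(G) + 2,
-- where γ_tR(G - e) = ∞ if e is incident with a vertex of degree 1
-- (so those edges impose no condition).  For the other edges, the
-- inequality is expressed as: every TRD-function of G - e has weight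
-- at least γ_tR(G) + 2.
ERSupercritical : ∀ {n} → Adj n → Set
ERSupercritical {n} a =
  ∀ (u v : Fin n) → a u v ≡ true → 2 ≤ deg a u → 2 ≤ deg a v →
  ∀ (k : ℕ) → IsGammaTR a k →
  ∀ (f : Labelling n) → IsTRDF (deleteEdge a u v) f → k + 2 ≤ weight f

IsStar : ∀ {n} → Adj n → Set
IsStar {n} a =
  Σ (Fin n) λ c →
    (∃[ w ] (w ≢ c)) ×
    (∀ v → v ≢ c → a c v ≡ true) ×
    (∀ u v → u ≢ c → v ≢ c → a u v ≡ false)

IsDoubleStar3 : ∀ {n} → Adj n → Set
IsDoubleStar3 {n} a =
  Σ (Fin n) λ p → Σ (Fin n) λ q →
    (p ≢ q) × (a p q ≡ true) ×
    (∀ v → v ≢ p → v ≢ q →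
       (a p v ≡ true × a q v ≡ false) ⊎ (a p v ≡ false × a q v ≡ true)) ×
    (∀ u v → u ≢ p → u ≢ q → v ≢ p → v ≢ q → a u v ≡ false) ×
    (3 ≤ deg a p) × (3 ≤ deg a q)

-- Stars have no edge joining two vertices of degree ≥ 2, so they are vacuously supercritical.
-- In a double star with centres p, q of degree ≥ 3, labelling both centres 2 shows γtR ≤ 4,
-- while in G − pq each centre together with its leaves carries weight ≥ 3.
-- Conversely, let f be a γtR-function of a supercritical G and uv an edge whose ends have
-- degree ≥ 2, so that no TRDF of G − uv weighs at most γtR + 1. Small relabellings of f
-- would produce one unless f u, f v > 0, every other neighbour of u or v is a leaf labelled 0,
-- and u, v have degree ≥ 3; by connectivity G is then a double star. If there is no such
-- edge, G is a star.

module Submission where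

open import Defs hiding (sym)
open import Data.Nat using (ℕ; zero; suc; _+_; _≤_; _<_; z≤n; s≤s; _≤?_)
open import Data.Nat.Properties
  using (≤-refl; ≤-trans; ≤-reflexive; +-comm; +-assoc; +-identityʳ; +-monoʳ-≤; +-mono-≤;
         +-cancelˡ-≤; +-cancelʳ-≡; +-monoˡ-≤; ≮⇒≥; m<1+n⇒m<n∨m≡n; n≢0⇒n>0; +-0-monoid)
import Data.Nat.Properties as ℕ
open import Data.Fin using (Fin; zero; suc; toℕ; fromℕ<)
open import Data.Fin.Properties using (_≟_; any?; all?; suc-injective)
open import Data.Bool using (Bool; true; false; _∧_; not; if_then_else_)
open import Data.Bool.Properties using (T-≡; ∨-comm; ∧-zeroʳ)
import Data.Bool.Properties as Bool
open import Data.List using (List; []; _∷_; _++_; length; filterᵇ; map; tabulate; allFin)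
open import Data.List.Properties using (map-tabulate; map-cong; map-cong-local; map-++; filter-all)
open import Data.List.Relation.Unary.All using (All; []; _∷_; lookup)
import Data.List.Relation.Unary.All as All
import Data.List.Membership.Propositional as Membership
open import Data.List.Relation.Unary.All.Properties using (all-filter)
open import Data.List.Relation.Unary.AllPairs using ([]; _∷_)
open import Data.List.Relation.Unary.Unique.Propositional using (Unique)
import Data.List.Relation.Unary.Unique.Propositional.Properties as Unique
open import Data.Nat.ListAction using (sum)
open import Data.Nat.ListAction.Properties using (sum-++)
open import Data.Vec.Functional using (updateAt)
open import Data.Vec.Functional.Properties using (updateAt-updates; updateAt-minimal)
import Data.Vec.Functional as Vector
open import Algebra.Properties.Monoid.Sum +-0-monoid using (sum-cong-≗; sum-replicate-zero)
  renaming (sum to ∑)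
open import Data.Product using (_×_; ∃; ∃-syntax; ∃₂; _,_; proj₁; proj₂)
import Data.Product as Product
open import Data.Sum using (_⊎_; inj₁; inj₂; [_,_]′)
import Data.Sum as Sum
open import Data.Empty using (⊥; ⊥-elim)
open import Function using (_∘_; id; const; _⇔_; mk⇔; Equivalence)
open import Relation.Nullary using (¬_; Dec; yes; no; contradiction)
open import Relation.Nullary.Decidable using (_×-dec_; _→-dec_; ¬?; T?; dec-true)
import Relation.Nullary.Decidable as Dec
open import Level using (0ℓ)
open import Relation.Unary using (Pred; Decidable)
open import Relation.Binary.Definitions using (DecidableEquality)
open import Relation.Binary.PropositionalEquality
  using (_≡_; _≢_; refl; sym; trans; cong; cong₂; subst; _≗_; module ≡-Reasoning)
open import Relation.Binary.Construct.Closure.ReflexiveTransitive using (fold)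

private
  variable
    n : ℕ

sum-tabulate : (h : Fin n → ℕ) → sum (tabulate h) ≡ ∑ h
sum-tabulate {zero}  h = refl
sum-tabulate {suc n} h = cong (h zero +_) (sum-tabulate (h ∘ suc))

sum-map-allFin : (h : Fin n → ℕ) → sum (map h (allFin n)) ≡ ∑ h
sum-map-allFin h = trans (cong sum (map-tabulate id h)) (sum-tabulate h)

∑-update : (h h′ : Fin n → ℕ) (w : Fin n) → (∀ x → x ≢ w → h′ x ≡ h x) →
           ∑ h′ + h w ≡ ∑ h + h′ w
∑-update {suc n} h h′ zero agree = begin
  (h′ zero + ∑ (h′ ∘ suc)) + h zero  ≡⟨ cong (λ s → (h′ zero + s) + h zero) (sum-cong-≗ λ x → agree (suc x) λ ()) ⟩
  (h′ zero + ∑ (h ∘ suc)) + h zero   ≡⟨ +-assoc (h′ zero) _ _ ⟩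
  h′ zero + (∑ (h ∘ suc) + h zero)   ≡⟨ cong (h′ zero +_) (+-comm _ (h zero)) ⟩
  h′ zero + (h zero + ∑ (h ∘ suc))   ≡⟨ +-comm (h′ zero) _ ⟩
  (h zero + ∑ (h ∘ suc)) + h′ zero   ∎
  where open ≡-Reasoning
∑-update {suc n} h h′ (suc w) agree = begin
  (h′ zero + ∑ (h′ ∘ suc)) + h (suc w)  ≡⟨ +-assoc (h′ zero) _ _ ⟩
  h′ zero + (∑ (h′ ∘ suc) + h (suc w))  ≡⟨ cong₂ _+_ (agree zero λ ()) (∑-update (h ∘ suc) (h′ ∘ suc) w agree-suc) ⟩
  h zero + (∑ (h ∘ suc) + h′ (suc w))   ≡⟨ +-assoc (h zero) _ _ ⟨
  (h zero + ∑ (h ∘ suc)) + h′ (suc w)   ∎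
  where
  open ≡-Reasoning
  agree-suc : ∀ x → x ≢ w → h′ (suc x) ≡ h (suc x)
  agree-suc x x≢w = agree (suc x) (x≢w ∘ suc-injective)

sum-unique≤∑ : (h : Fin n → ℕ) {xs : List (Fin n)} → Unique xs → sum (map h xs) ≤ ∑ h
sum-unique≤∑ h {[]}     []                     = z≤n
sum-unique≤∑ h {x ∷ xs} (x∉xs ∷ xs-unique) = begin
  h x + sum (map h xs)   ≡⟨ cong (λ ys → h x + sum ys) (map-cong-local (All.map (λ x≢y → sym (h₀-agrees _ (x≢y ∘ sym))) x∉xs)) ⟩
  h x + sum (map h₀ xs)  ≤⟨ +-monoʳ-≤ (h x) (sum-unique≤∑ h₀ xs-unique) ⟩
  h x + ∑ h₀             ≡⟨ +-comm (h x) (∑ h₀) ⟩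
  ∑ h₀ + h x             ≡⟨ ∑-update h h₀ x h₀-agrees ⟩
  ∑ h + h₀ x             ≡⟨ cong (∑ h +_) (updateAt-updates x h) ⟩
  ∑ h + 0                ≡⟨ +-identityʳ (∑ h) ⟩
  ∑ h                    ∎
  where
  open ℕ.≤-Reasoning
  h₀ : Fin _ → ℕ
  h₀ = updateAt h x (const 0)
  h₀-agrees : ∀ y → y ≢ x → h₀ y ≡ h y
  h₀-agrees y = updateAt-minimal y x h

length-filterᵇ : {A : Set} (p : A → Bool) (xs : List A) →
                 length (filterᵇ p xs) ≡ sum (map (λ x → if p x then 1 else 0) xs)
length-filterᵇ p []       = refl
length-filterᵇ p (x ∷ xs) with p x
... | true  = cong suc (length-filterᵇ p xs)
... | false = length-filterᵇ p xs

module _ {A : Set} (_≟ᴬ_ : DecidableEquality A) {P : Pred A 0ℓ} where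

  unique-avoiding-one : {xs : List A} → Unique xs → All P xs → 2 ≤ length xs →
                        ∀ w → ∃[ x ] (P x × x ≢ w)
  unique-avoiding-one {_ ∷ []} _ _ (s≤s ())
  unique-avoiding-one {x ∷ y ∷ _} ((x≢y ∷ _) ∷ _) (px ∷ py ∷ _) _ w with x ≟ᴬ w
  ... | no x≢w   = x , px , x≢w
  ... | yes refl = y , py , x≢y ∘ sym

  unique-avoiding-two : {xs : List A} → Unique xs → All P xs → 3 ≤ length xs →
                        ∀ w → ∃₂ λ x y → P x × P y × x ≢ w × y ≢ w × x ≢ y
  unique-avoiding-two {_ ∷ []}     _ _ (s≤s ())
  unique-avoiding-two {_ ∷ _ ∷ []} _ _ (s≤s (s≤s ()))
  unique-avoiding-two {x ∷ y ∷ z ∷ _} ((x≢y ∷ x≢z ∷ _) ∷ (y≢z ∷ _) ∷ _) (px ∷ py ∷ pz ∷ _) _ w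
    with x ≟ᴬ w | y ≟ᴬ w
  ... | yes refl | _        = y , z , py , pz , x≢y ∘ sym , x≢z ∘ sym , y≢z
  ... | no x≢w   | yes refl = x , z , px , pz , x≢w , y≢z ∘ sym , x≢z
  ... | no x≢w   | no y≢w   = x , y , px , py , x≢w , y≢w , x≢y

neighbours : Adj n → Fin n → List (Fin n)
neighbours a v = filterᵇ (a v) (allFin _)

neighbours-unique : (a : Adj n) (v : Fin n) → Unique (neighbours a v)
neighbours-unique {n} a v = Unique.filter⁺ (T? ∘ a v) (Unique.allFin⁺ n)

neighbours-adjacent : (a : Adj n) (v : Fin n) → All (λ y → a v y ≡ true) (neighbours a v)
neighbours-adjacent {n} a v = All.map (Equivalence.to T-≡) (all-filter (T? ∘ a v) (allFin n))

other-neighbour : (a : Adj n) {v : Fin n} → 2 ≤ deg a v → ∀ w → ∃[ x ] (a v x ≡ true × x ≢ w)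
other-neighbour a {v} = unique-avoiding-one _≟_ (neighbours-unique a v) (neighbours-adjacent a v)

two-other-neighbours : (a : Adj n) {v : Fin n} → 3 ≤ deg a v →
                       ∀ w → ∃₂ λ x y → a v x ≡ true × a v y ≡ true × x ≢ w × y ≢ w × x ≢ y
two-other-neighbours a {v} = unique-avoiding-two _≟_ (neighbours-unique a v) (neighbours-adjacent a v)

unique-neighbours≤deg : (a : Adj n) (v : Fin n) {xs : List (Fin n)} →
                        Unique xs → All (λ y → a v y ≡ true) xs → length xs ≤ deg a v
unique-neighbours≤deg {n} a v {xs} xs-unique xs-adjacent = begin
  length xs                     ≡⟨ cong length (filter-all (T? ∘ a v) (All.map (Equivalence.from T-≡) xs-adjacent)) ⟨
  length (filterᵇ (a v) xs)     ≡⟨ length-filterᵇ (a v) xs ⟩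
  sum (map indicator xs)        ≤⟨ sum-unique≤∑ indicator xs-unique ⟩
  ∑ indicator                   ≡⟨ sum-map-allFin indicator ⟨
  sum (map indicator (allFin n)) ≡⟨ length-filterᵇ (a v) (allFin n) ⟨
  deg a v                       ∎
  where
  open ℕ.≤-Reasoning
  indicator : Fin n → ℕ
  indicator y = if a v y then 1 else 0

two-neighbours⇒deg≥2 : (a : Adj n) {v x y : Fin n} →
                       a v x ≡ true → a v y ≡ true → x ≢ y → 2 ≤ deg a v
two-neighbours⇒deg≥2 a avx avy x≢y = unique-neighbours≤deg a _ ((x≢y ∷ []) ∷ [] ∷ []) (avx ∷ avy ∷ [])

three-neighbours⇒deg≥3 : (a : Adj n) {v x y z : Fin n} →
                         a v x ≡ true → a v y ≡ true → a v z ≡ true → x ≢ y → x ≢ z → y ≢ z → 3 ≤ deg a v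
three-neighbours⇒deg≥3 a avx avy avz x≢y x≢z y≢z =
  unique-neighbours≤deg a _ ((x≢y ∷ x≢z ∷ []) ∷ (y≢z ∷ []) ∷ [] ∷ []) (avx ∷ avy ∷ avz ∷ [])

==∧==-false : {x u y v : Fin n} → ¬ (x ≡ u × y ≡ v) → ((x == u) ∧ (y == v)) ≡ false
==∧==-false {x = x} {u} {y} {v} ¬eq with x ≟ u | y ≟ v
... | yes refl | yes refl = contradiction (refl , refl) ¬eq
... | yes _    | no _     = refl
... | no _     | _        = refl

deleteEdge-intro : (a : Adj n) {u v x y : Fin n} → a x y ≡ true →
                   ¬ (x ≡ u × y ≡ v) → ¬ (x ≡ v × y ≡ u) → deleteEdge a u v x y ≡ true
deleteEdge-intro a axy ¬uv ¬vu rewrite axy | ==∧==-false ¬uv | ==∧==-false ¬vu = refl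

deleteEdge-away : (a : Adj n) {u v x y : Fin n} → a x y ≡ true → x ≢ u → x ≢ v →
                  deleteEdge a u v x y ≡ true
deleteEdge-away a axy x≢u x≢v = deleteEdge-intro a axy (x≢u ∘ proj₁) (x≢v ∘ proj₁)

deleteEdge-⊆ : (a : Adj n) {u v x y : Fin n} → deleteEdge a u v x y ≡ true → a x y ≡ true
deleteEdge-⊆ a {x = x} {y} h with a x y
... | true  = refl
... | false = h

deleteEdge-removes : (a : Adj n) {u v y : Fin n} → deleteEdge a u v u y ≡ true → y ≢ v
deleteEdge-removes a {u} {v} h refl
  rewrite dec-true (u ≟ u) refl | dec-true (v ≟ v) refl | ∧-zeroʳ (a u v) with () ← h

deleteEdge-comm : (a : Adj n) (u v x y : Fin n) → deleteEdge a u v x y ≡ deleteEdge a v u x y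
deleteEdge-comm a u v x y = cong (λ b → a x y ∧ not b) (∨-comm ((x == u) ∧ (y == v)) _)

endpoint-or-away : {u v : Fin n} (z : Fin n) → z ≡ u ⊎ z ≡ v ⊎ (z ≢ u × z ≢ v)
endpoint-or-away {u = u} {v} z with z ≟ u | z ≟ v
... | yes z≡u | _       = inj₁ z≡u
... | no _    | yes z≡v = inj₂ (inj₁ z≡v)
... | no z≢u  | no z≢v  = inj₂ (inj₂ (z≢u , z≢v))

Pendant : Adj n → Fin n → Fin n → Set
Pendant a x c = ∀ y → a x y ≡ true → y ≡ c

pendant⇒deg<2 : (a : Adj n) {x c : Fin n} → Pendant a x c → ¬ 2 ≤ deg a x
pendant⇒deg<2 a {c = c} pendant d with other-neighbour a d c
... | y , axy , y≢c = y≢c (pendant y axy)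

pendant-deleteEdge : (a : Adj n) {u v x c : Fin n} → Pendant a x c → Pendant (deleteEdge a u v) x c
pendant-deleteEdge a pendant y = pendant y ∘ deleteEdge-⊆ a

InnerEdge : Adj n → Fin n → Fin n → Set
InnerEdge a u v = a u v ≡ true × 2 ≤ deg a u × 2 ≤ deg a v

connected-closed : {a : Adj n} → Connected a → (Q : Pred (Fin n) 0ℓ) →
                   (∀ {x y} → a x y ≡ true → Q x → Q y) → ∀ {x} → Q x → ∀ y → Q y
connected-closed conn Q step {x} qx y = fold (λ x y → Q x → Q y) (λ axy k → k ∘ step axy) id (conn x y) qx

module _ (G : Graph n) where
  private
    a = adj G

  adj-sym : {x y : Fin n} → a x y ≡ true → a y x ≡ true
  adj-sym {x} {y} = trans (Graph.sym G y x)

  adj-irrefl : {x y : Fin n} → a x y ≡ true → x ≢ y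
  adj-irrefl {x} axy refl with () ← trans (sym axy) (Graph.irrefl G x)

  lone-neighbour : {x y z : Fin n} → ¬ 2 ≤ deg a x → a x y ≡ true → a x z ≡ true → z ≡ y
  lone-neighbour {y = y} {z} deg<2 axy axz with z ≟ y
  ... | yes z≡y = z≡y
  ... | no z≢y  = contradiction (two-neighbours⇒deg≥2 a axz axy z≢y) deg<2

  star-shape : Connected a → {c : Fin n} → (∀ y → a c y ≡ true → Pendant a y c) →
               (∀ v → v ≢ c → a c v ≡ true) × (∀ u v → u ≢ c → v ≢ c → a u v ≡ false)
  star-shape conn {c} leaves = spoke , no-other-edge
    where
    near : ∀ x → x ≡ c ⊎ a c x ≡ true
    near = connected-closed conn (λ x → x ≡ c ⊎ a c x ≡ true) step (inj₁ refl)
      where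
      step : ∀ {x y} → a x y ≡ true → x ≡ c ⊎ a c x ≡ true → y ≡ c ⊎ a c y ≡ true
      step axy (inj₁ refl) = inj₂ axy
      step axy (inj₂ acx)  = inj₁ (leaves _ acx _ axy)
    spoke : ∀ v → v ≢ c → a c v ≡ true
    spoke v v≢c = [ ⊥-elim ∘ v≢c , id ]′ (near v)
    no-other-edge : ∀ u v → u ≢ c → v ≢ c → a u v ≡ false
    no-other-edge u v u≢c v≢c = Bool.¬-not λ auv → v≢c (leaves u (spoke u u≢c) v auv)

  inner-edge-sym : {u v : Fin n} → InnerEdge a u v → InnerEdge a v u
  inner-edge-sym (auv , deg-u , deg-v) = adj-sym auv , deg-v , deg-u

  pendant-neighbours⇒star : Connected a → {c w : Fin n} → a c w ≡ true →
                            (∀ w → a c w ≡ true → Pendant a w c) → IsStar a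
  pendant-neighbours⇒star conn acw leaves = _ , (_ , adj-irrefl acw ∘ sym) , star-shape conn leaves

  no-inner-edge⇒pendant-neighbours : (∀ u v → ¬ InnerEdge a u v) → {c : Fin n} → 2 ≤ deg a c →
                                     ∀ w → a c w ≡ true → Pendant a w c
  no-inner-edge⇒pendant-neighbours no-inner {c} deg-c w acw z awz with z ≟ c
  ... | yes z≡c = z≡c
  ... | no z≢c  = contradiction (acw , deg-c , two-neighbours⇒deg≥2 a (adj-sym acw) awz (z≢c ∘ sym)) (no-inner c w)

  no-inner-edge⇒star : Connected a → {x y : Fin n} → a x y ≡ true → (∀ u v → ¬ InnerEdge a u v) → IsStar a
  no-inner-edge⇒star conn {x} {y} axy no-inner with 2 ≤? deg a x | 2 ≤? deg a y
  ... | yes deg-x | _         =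
    pendant-neighbours⇒star conn axy (no-inner-edge⇒pendant-neighbours no-inner deg-x)
  ... | no _      | yes deg-y =
    pendant-neighbours⇒star conn (adj-sym axy) (no-inner-edge⇒pendant-neighbours no-inner deg-y)
  ... | no deg-x  | no deg-y  = pendant-neighbours⇒star conn axy λ w axw z awz →
    lone-neighbour deg-y (adj-sym axy) (subst (λ w → a w z ≡ true) (lone-neighbour deg-x axy axw) awz)

  AttachedToOne : Fin n → Fin n → Set
  AttachedToOne p q = ∀ v → v ≢ p → v ≢ q → (a p v ≡ true × a q v ≡ false) ⊎ (a p v ≡ false × a q v ≡ true)

  IndependentOutside : Fin n → Fin n → Set
  IndependentOutside p q = ∀ u v → u ≢ p → u ≢ q → v ≢ p → v ≢ q → a u v ≡ false

  -- Definitionally, IsDoubleStar3 a is Σ p Σ q DoubleStarOn p q.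
  DoubleStarOn : Fin n → Fin n → Set
  DoubleStarOn p q =
    (p ≢ q) × (a p q ≡ true) × AttachedToOne p q × IndependentOutside p q × (3 ≤ deg a p) × (3 ≤ deg a q)

  double-star-shape : Connected a → {u v : Fin n} → a u v ≡ true →
                      (∀ w → a u w ≡ true → w ≢ v → Pendant a w u) → (∀ w → a v w ≡ true → w ≢ u → Pendant a w v) →
                      AttachedToOne u v × IndependentOutside u v
  double-star-shape conn {u} {v} auv leaves-u leaves-v = attached , no-other-edge
    where
    Near : Fin n → Set
    Near x = x ≡ u ⊎ x ≡ v ⊎ a u x ≡ true ⊎ a v x ≡ true
    step : ∀ {x y} → a x y ≡ true → Near x → Near y
    step axy (inj₁ refl)                  = inj₂ (inj₂ (inj₁ axy))
    step axy (inj₂ (inj₁ refl))           = inj₂ (inj₂ (inj₂ axy))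
    step {x} axy (inj₂ (inj₂ (inj₁ aux))) with x ≟ v
    ... | yes refl = inj₂ (inj₂ (inj₂ axy))
    ... | no x≢v   = inj₁ (leaves-u x aux x≢v _ axy)
    step {x} axy (inj₂ (inj₂ (inj₂ avx))) with x ≟ u
    ... | yes refl = inj₂ (inj₂ (inj₁ axy))
    ... | no x≢u   = inj₂ (inj₁ (leaves-v x avx x≢u _ axy))
    u≢v : u ≢ v
    u≢v = adj-irrefl auv
    attached : AttachedToOne u v
    attached x x≢u x≢v with connected-closed conn Near step (inj₁ refl) x
    ... | inj₁ x≡u                = contradiction x≡u x≢u
    ... | inj₂ (inj₁ x≡v)         = contradiction x≡v x≢v
    ... | inj₂ (inj₂ (inj₁ aux)) = inj₁ (aux , Bool.¬-not λ avx → u≢v (sym (leaves-u x aux x≢v v (adj-sym avx))))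
    ... | inj₂ (inj₂ (inj₂ avx)) = inj₂ (Bool.¬-not (λ aux → u≢v (leaves-v x avx x≢u u (adj-sym aux))) , avx)
    no-other-edge : IndependentOutside u v
    no-other-edge x y x≢u x≢v y≢u y≢v = Bool.¬-not λ axy →
      [ (λ (aux , _) → y≢u (leaves-u x aux x≢v y axy)) , (λ (_ , avx) → y≢v (leaves-v x avx x≢u y axy)) ]′
      (attached x x≢u x≢v)

  double-star-swap : {p q : Fin n} → DoubleStarOn p q → DoubleStarOn q p
  double-star-swap (p≢q , apq , attached , no-other-edge , deg-p , deg-q) =
    p≢q ∘ sym , adj-sym apq ,
    (λ v v≢q v≢p → Sum.swap (Sum.map Product.swap Product.swap (attached v v≢p v≢q))) ,
    (λ x y x≢q x≢p y≢q y≢p → no-other-edge x y x≢p x≢q y≢p y≢q) , deg-q , deg-p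

  double-star-leaves : {p q : Fin n} → DoubleStarOn p q → ∀ x → a p x ≡ true → x ≢ q → Pendant a x p
  double-star-leaves {p} {q} (_ , _ , attached , no-other-edge , _) x apx x≢q y axy with y ≟ p | y ≟ q
  ... | yes y≡p | _        = y≡p
  ... | no _    | yes refl with attached x (adj-irrefl apx ∘ sym) x≢q
  ...   | inj₁ (_ , aqx) with () ← trans (sym (adj-sym axy)) aqx
  ...   | inj₂ (apx′ , _) with () ← trans (sym apx) apx′
  double-star-leaves {p} {q} (_ , _ , attached , no-other-edge , _) x apx x≢q y axy | no y≢p | no y≢q
    with () ← trans (sym axy) (no-other-edge x y (adj-irrefl apx ∘ sym) x≢q y≢p y≢q)

  double-star-inner-vertex : {p q x : Fin n} → DoubleStarOn p q → 2 ≤ deg a x → x ≡ p ⊎ x ≡ q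
  double-star-inner-vertex {p} {q} {x} ds@(_ , _ , attached , _) deg≥2 with x ≟ p | x ≟ q
  ... | yes x≡p | _       = inj₁ x≡p
  ... | no _    | yes x≡q = inj₂ x≡q
  ... | no x≢p  | no x≢q  with attached x x≢p x≢q
  ...   | inj₁ (apx , _) = contradiction deg≥2 (pendant⇒deg<2 a (double-star-leaves ds x apx x≢q))
  ...   | inj₂ (_ , aqx) =
    contradiction deg≥2 (pendant⇒deg<2 a (double-star-leaves (double-star-swap ds) x aqx x≢p))

one two : Fin 3
one = suc zero
two = suc (suc zero)

_[_≔_] : Labelling n → Fin n → Fin 3 → Labelling n
f [ w ≔ c ] = updateAt f w (const c)

≔-here : (f : Labelling n) (w : Fin n) (c : Fin 3) → (f [ w ≔ c ]) w ≡ c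
≔-here f w c = updateAt-updates w f

≔-elsewhere : (f : Labelling n) {w x : Fin n} {c : Fin 3} → x ≢ w → (f [ w ≔ c ]) x ≡ f x
≔-elsewhere f {w} {x} = updateAt-minimal x w f

≔-here-positive : (f : Labelling n) {w : Fin n} {c : Fin 3} → toℕ c ≢ 0 → toℕ ((f [ w ≔ c ]) w) ≢ 0
≔-here-positive f {w} {c} c≢0 = c≢0 ∘ trans (cong toℕ (sym (≔-here f w c)))

≔-positive : (f : Labelling n) {w x : Fin n} {c : Fin 3} →
             toℕ c ≢ 0 → toℕ (f x) ≢ 0 → toℕ ((f [ w ≔ c ]) x) ≢ 0
≔-positive f {w} {x} {c} c≢0 fx≢0 with x ≟ w
... | yes refl = ≔-here-positive f c≢0
... | no x≢w   = fx≢0 ∘ trans (cong toℕ (sym (≔-elsewhere f x≢w)))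

weight≡∑ : (f : Labelling n) → weight f ≡ ∑ (toℕ ∘ f)
weight≡∑ f = sum-map-allFin (toℕ ∘ f)

weight-cong : {f g : Labelling n} → f ≗ g → weight f ≡ weight g
weight-cong {n} f≗g = cong sum (map-cong (cong toℕ ∘ f≗g) (allFin n))

weight-zero : weight {n} (const zero) ≡ 0
weight-zero {n} = trans (weight≡∑ {n} (const zero)) (sum-replicate-zero n)

weight-≔ : (f : Labelling n) (w : Fin n) (c : Fin 3) →
           weight (f [ w ≔ c ]) + toℕ (f w) ≡ weight f + toℕ c
weight-≔ f w c = begin
  weight (f [ w ≔ c ]) + toℕ (f w)     ≡⟨ cong (_+ toℕ (f w)) (weight≡∑ (f [ w ≔ c ])) ⟩
  ∑ (toℕ ∘ (f [ w ≔ c ])) + toℕ (f w)  ≡⟨ ∑-update (toℕ ∘ f) _ w (λ x x≢w → cong toℕ (≔-elsewhere f x≢w)) ⟩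
  ∑ (toℕ ∘ f) + toℕ ((f [ w ≔ c ]) w)  ≡⟨ cong₂ _+_ (weight≡∑ f) (cong toℕ (sym (≔-here f w c))) ⟨
  weight f + toℕ c                     ∎
  where open ≡-Reasoning

weight-≔-from-zero : (f : Labelling n) {w : Fin n} {c : Fin 3} → toℕ (f w) ≡ 0 →
                     weight (f [ w ≔ c ]) ≡ weight f + toℕ c
weight-≔-from-zero f {w} {c} fw≡0 =
  trans (sym (+-identityʳ _)) (trans (cong (weight (f [ w ≔ c ]) +_) (sym fw≡0)) (weight-≔ f w c))

IsTRDF-cong : {a b : Adj n} {f g : Labelling n} →
              (∀ x y → a x y ≡ b x y) → f ≗ g → IsTRDF a f → IsTRDF b g
IsTRDF-cong {f = f} {g} a≡b f≗g (dominated , supported) = dominated′ , supported′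
  where
  value : ∀ x → toℕ (f x) ≡ toℕ (g x)
  value x = cong toℕ (f≗g x)
  dominated′ : ∀ v → toℕ (g v) ≡ 0 → ∃[ u ] (_ × toℕ (g u) ≡ 2)
  dominated′ v gv≡0 with dominated v (trans (value v) gv≡0)
  ... | u , avu , fu≡2 = u , trans (sym (a≡b v u)) avu , trans (sym (value u)) fu≡2
  supported′ : ∀ v → toℕ (g v) ≢ 0 → ∃[ u ] (_ × toℕ (g u) ≢ 0)
  supported′ v gv≢0 with supported v (gv≢0 ∘ trans (sym (value v)))
  ... | u , avu , fu≢0 = u , trans (sym (a≡b v u)) avu , fu≢0 ∘ trans (value u)

IsTRDF? : (a : Adj n) (f : Labelling n) → Dec (IsTRDF a f)
IsTRDF? a f =
  all? (λ v → (toℕ (f v) ℕ.≟ 0) →-dec any? (λ u → (a v u Bool.≟ true) ×-dec (toℕ (f u) ℕ.≟ 2))) ×-dec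
  all? (λ v → ¬? (toℕ (f v) ℕ.≟ 0) →-dec any? (λ u → (a v u Bool.≟ true) ×-dec ¬? (toℕ (f u) ℕ.≟ 0)))

pendant-anchor-positive : (a : Adj n) {g : Labelling n} {l c : Fin n} →
                          IsTRDF a g → Pendant a l c → toℕ (g c) ≢ 0
pendant-anchor-positive a {g} {l} (dominated , supported) pendant gc≡0 with toℕ (g l) ℕ.≟ 0
... | yes gl≡0 with y , aly , gy≡2 ← dominated l gl≡0 rewrite pendant y aly
  with () ← trans (sym gy≡2) gc≡0
... | no gl≢0 with y , aly , gy≢0 ← supported l gl≢0 rewrite pendant y aly = gy≢0 gc≡0

pendant-positive : (a : Adj n) {g : Labelling n} {l c : Fin n} →
                   IsTRDF a g → Pendant a l c → toℕ (g c) ≢ 2 → toℕ (g l) ≢ 0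
pendant-positive a (dominated , _) pendant gc≢2 gl≡0 with y , aly , gy≡2 ← dominated _ gl≡0
  rewrite pendant y aly = gc≢2 gy≡2

SatisfiedWithout : Adj n → Labelling n → Fin n → Fin n → Set
SatisfiedWithout a g u v =
  (toℕ (g u) ≡ 0 → ∃[ w ] (a u w ≡ true × w ≢ v × toℕ (g w) ≡ 2)) ×
  (toℕ (g u) ≢ 0 → ∃[ w ] (a u w ≡ true × w ≢ v × toℕ (g w) ≢ 0))

satisfied-positive : (a : Adj n) {g : Labelling n} {u v : Fin n} → toℕ (g u) ≢ 0 →
                     ∃[ w ] (a u w ≡ true × w ≢ v × toℕ (g w) ≢ 0) → SatisfiedWithout a g u v
satisfied-positive a gu≢0 backup = (λ gu≡0 → contradiction gu≡0 gu≢0) , const backup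

satisfied-zero : (a : Adj n) {g : Labelling n} {u v : Fin n} → toℕ (g u) ≡ 0 →
                 ∃[ w ] (a u w ≡ true × w ≢ v × toℕ (g w) ≡ 2) → SatisfiedWithout a g u v
satisfied-zero a gu≡0 dominator = const dominator , (λ gu≢0 → contradiction gu≡0 gu≢0)

satisfied-beside-zero : {a : Adj n} {g : Labelling n} {u v : Fin n} →
                        IsTRDF a g → toℕ (g u) ≡ 0 → SatisfiedWithout a g v u
satisfied-beside-zero {g = g} {u} {v} (dominated , supported) gu≡0 =
  (λ gv≡0 → let w , avw , gw≡2 = dominated v gv≡0 in
             w , avw , (λ { refl → contradiction (trans (sym gw≡2) gu≡0) λ () }) , gw≡2) ,
  (λ gv≢0 → let w , avw , gw≢0 = supported v gv≢0 in w , avw , (λ { refl → gw≢0 gu≡0 }) , gw≢0)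

-- Deleting uv can only break the TRDF conditions at u and v.
trdf-deleteEdge : {a : Adj n} {g : Labelling n} {u v : Fin n} → IsTRDF a g →
                  SatisfiedWithout a g u v → SatisfiedWithout a g v u → IsTRDF (deleteEdge a u v) g
trdf-deleteEdge {n} {a} {g} {u} {v} (dominated , supported) (dominated-u , supported-u) (dominated-v , supported-v) =
  (λ z gz≡0 → relocate {P = λ i → toℕ i ≡ 2} (dominated z gz≡0)
                (λ { refl → dominated-u gz≡0 }) (λ { refl → dominated-v gz≡0 })) ,
  (λ z gz≢0 → relocate {P = λ i → toℕ i ≢ 0} (supported z gz≢0)
                (λ { refl → supported-u gz≢0 }) (λ { refl → supported-v gz≢0 }))
  where
  relocate : {P : Fin 3 → Set} {z : Fin n} → ∃[ w ] (a z w ≡ true × P (g w)) →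
             (z ≡ u → ∃[ w ] (a u w ≡ true × w ≢ v × P (g w))) →
             (z ≡ v → ∃[ w ] (a v w ≡ true × w ≢ u × P (g w))) →
             ∃[ w ] (deleteEdge a u v z w ≡ true × P (g w))
  relocate {z = z} (w , azw , pw) at-u at-v with endpoint-or-away {u = u} {v} z
  ... | inj₁ refl with w′ , auw′ , w′≢v , pw′ ← at-u refl =
    w′ , deleteEdge-intro a auw′ (w′≢v ∘ proj₂) (λ (u≡v , w′≡u) → w′≢v (trans w′≡u u≡v)) , pw′
  ... | inj₂ (inj₁ refl) with w′ , avw′ , w′≢u , pw′ ← at-v refl =
    w′ , deleteEdge-intro a avw′ (λ (v≡u , w′≡v) → w′≢u (trans w′≡v v≡u)) (w′≢u ∘ proj₂) , pw′
  ... | inj₂ (inj₂ (z≢u , z≢v)) = w , deleteEdge-away a azw z≢u z≢v , pw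

≔-preserves-TRDF : {a : Adj n} {g : Labelling n} {w : Fin n} {c : Fin 3} → IsTRDF a g → toℕ c ≢ 0 →
                   (toℕ (g w) ≡ 0 → ∃[ x ] (a w x ≡ true × toℕ (g x) ≢ 0)) →
                   (toℕ (g w) ≡ 2 → toℕ c ≢ 2 → ∀ z → a z w ≡ true → toℕ (g z) ≢ 0) →
                   IsTRDF a (g [ w ≔ c ])
≔-preserves-TRDF {n} {a} {g} {w} {c} (dominated , supported) c≢0 newly-positive demoted = dominated′ , supported′
  where
  g′ : Labelling n
  g′ = g [ w ≔ c ]
  unchanged : ∀ {x} → x ≢ w → toℕ (g′ x) ≡ toℕ (g x)
  unchanged x≢w = cong toℕ (≔-elsewhere g x≢w)
  dominated′ : ∀ z → toℕ (g′ z) ≡ 0 → ∃[ x ] (a z x ≡ true × toℕ (g′ x) ≡ 2)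
  dominated′ z g′z≡0 with z ≟ w
  ... | yes refl = contradiction (trans (cong toℕ (sym (≔-here g z c))) g′z≡0) c≢0
  ... | no z≢w
    with gz≡0 ← trans (sym (unchanged z≢w)) g′z≡0
    with x , azx , gx≡2 ← dominated z gz≡0
    with x ≟ w | toℕ c ℕ.≟ 2
  ... | no x≢w   | _       = x , azx , trans (unchanged x≢w) gx≡2
  ... | yes refl | yes c≡2 = x , azx , trans (cong toℕ (≔-here g x c)) c≡2
  ... | yes refl | no c≢2  = contradiction gz≡0 (demoted gx≡2 c≢2 z azx)
  kept : ∀ {z} → ∃[ x ] (a z x ≡ true × toℕ (g x) ≢ 0) → ∃[ x ] (a z x ≡ true × toℕ (g′ x) ≢ 0)
  kept (x , azx , gx≢0) = x , azx , ≔-positive g c≢0 gx≢0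
  supported′ : ∀ z → toℕ (g′ z) ≢ 0 → ∃[ x ] (a z x ≡ true × toℕ (g′ x) ≢ 0)
  supported′ z g′z≢0 with z ≟ w | toℕ (g z) ℕ.≟ 0
  ... | yes refl | yes gz≡0 = kept (newly-positive gz≡0)
  ... | yes refl | no gz≢0  = kept (supported z gz≢0)
  ... | no z≢w   | _        = kept (supported z (g′z≢0 ∘ trans (unchanged z≢w)))

-- Existence of a γtR-function

any-function? : {m k : ℕ} {P : (Fin m → Fin k) → Set} → (∀ {f g} → f ≗ g → P f → P g) →
                (∀ f → Dec (P f)) → Dec (∃ P)
any-function? {zero} resp P? =
  Dec.map′ (Vector.[] ,_) (λ (f , p) → resp (λ ()) p) (P? Vector.[])
any-function? {suc m} resp P? =
  Dec.map′ (λ (c , f , p) → c Vector.∷ f , p)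
           (λ (f , p) → Vector.head f , Vector.tail f , resp (λ { zero → refl ; (suc i) → refl }) p)
           (any? λ c → any-function? (λ f≗g → resp (λ { zero → refl ; (suc i) → f≗g i })) (P? ∘ (c Vector.∷_)))

module _ {P : Pred ℕ 0ℓ} (P? : Decidable P) where

  Least : ℕ → Set
  Least k = P k × ∀ {j} → P j → k ≤ j

  least-or-none-below : ∀ m → ∃ Least ⊎ (∀ {j} → j < m → ¬ P j)
  least-or-none-below zero = inj₂ λ ()
  least-or-none-below (suc m) with least-or-none-below m | P? m
  ... | inj₁ found | _      = inj₁ found
  ... | inj₂ none  | yes pm = inj₁ (m , pm , λ pj → ≮⇒≥ λ j<m → none j<m pj)
  ... | inj₂ none  | no ¬pm = inj₂ λ j<1+m → [ none , (λ { refl → ¬pm }) ]′ (m<1+n⇒m<n∨m≡n j<1+m)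

  least : ∀ {m} → P m → ∃ Least
  least {m} pm = [ id , (λ none → contradiction pm (none ≤-refl)) ]′ (least-or-none-below (suc m))

γtR-exists : (a : Adj n) → NoIsolated a → ∃ (IsGammaTR a)
γtR-exists {n} a no-isolated = minimum (least TRDF-of-weight? (all-one , all-one-trdf , refl))
  where
  TRDF-of-weight? : ∀ m → Dec (∃[ f ] (IsTRDF a f × weight f ≡ m))
  TRDF-of-weight? m =
    any-function? (λ f≗g (trdf , w) → IsTRDF-cong (λ _ _ → refl) f≗g trdf , trans (sym (weight-cong f≗g)) w)
                  (λ f → IsTRDF? a f ×-dec (weight f ℕ.≟ m))
  all-one : Labelling n
  all-one = const one
  all-one-trdf : IsTRDF a all-one
  all-one-trdf = (λ _ ()) , λ v _ → let u , avu = no-isolated v in u , avu , λ ()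
  minimum : ∃ (Least TRDF-of-weight?) → ∃ (IsGammaTR a)
  minimum (k , witness , minimal) = k , witness , λ g g-trdf → minimal (g , g-trdf , refl)

-- Stars and double stars are supercritical

module _ (G : Graph n) where
  private
    a = adj G

  star-leaf-pendant : {c x : Fin n} → (∀ u v → u ≢ c → v ≢ c → a u v ≡ false) → x ≢ c → Pendant a x c
  star-leaf-pendant {c} {x} no-other-edge x≢c y axy with y ≟ c
  ... | yes y≡c = y≡c
  ... | no y≢c with () ← trans (sym axy) (no-other-edge x y x≢c y≢c)

  star⇒supercritical : IsStar a → ERSupercritical a
  star⇒supercritical (c , _ , _ , no-other-edge) u v auv deg-u deg-v with u ≟ c
  ... | yes refl = ⊥-elim (pendant⇒deg<2 a (star-leaf-pendant no-other-edge (adj-irrefl G auv ∘ sym)) deg-v)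
  ... | no u≢c   = ⊥-elim (pendant⇒deg<2 a (star-leaf-pendant no-other-edge u≢c) deg-u)

  Side : Fin n → Fin n → Fin n → Set
  Side p q x = x ≡ p ⊎ (a p x ≡ true × x ≢ q)

  sides-disjoint : {p q x : Fin n} → DoubleStarOn G p q → Side p q x → Side q p x → ⊥
  sides-disjoint (p≢q , _) (inj₁ refl) (inj₁ refl)             = p≢q refl
  sides-disjoint _         (inj₁ refl) (inj₂ (_ , p≢p))        = p≢p refl
  sides-disjoint _         (inj₂ (_ , q≢q)) (inj₁ refl)        = q≢q refl
  sides-disjoint {x = x} (_ , _ , attached , _) (inj₂ (apx , x≢q)) (inj₂ (aqx , x≢p))
    with attached x x≢p x≢q
  ... | inj₁ (_ , aqx′) with () ← trans (sym aqx) aqx′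
  ... | inj₂ (apx′ , _) with () ← trans (sym apx) apx′

  deleted-double-star-leaf : {p q x : Fin n} → DoubleStarOn G p q → a p x ≡ true → x ≢ q →
                             Pendant (deleteEdge a p q) x p
  deleted-double-star-leaf ds apx x≢q = pendant-deleteEdge a (double-star-leaves G ds _ apx x≢q)

  -- In G − pq a centre labelled 0 leaves its leaves unprotected, a centre labelled 1 forces
  -- every leaf to be positive, and a centre labelled 2 needs a positive leaf.
  side-weight≥3 : {p q : Fin n} {g : Labelling n} → DoubleStarOn G p q → IsTRDF (deleteEdge a p q) g →
                  ∃[ L ] (Unique L × All (Side p q) L × 3 ≤ sum (map (toℕ ∘ g) L))
  side-weight≥3 {p} {q} {g} ds@(_ , _ , _ , _ , deg-p , _) trdf
    with A , B , apA , apB , A≢q , B≢q , A≢B ← two-other-neighbours a deg-p q | g p in gp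
  ... | zero = contradiction (cong toℕ gp) (pendant-anchor-positive _ trdf (deleted-double-star-leaf ds apA A≢q))
  ... | suc zero =
    (p ∷ A ∷ B ∷ []) , ((adj-irrefl G apA ∷ adj-irrefl G apB ∷ []) ∷ (A≢B ∷ []) ∷ [] ∷ []) ,
    (inj₁ refl ∷ inj₂ (apA , A≢q) ∷ inj₂ (apB , B≢q) ∷ []) ,
    subst (λ t → 3 ≤ t + (toℕ (g A) + (toℕ (g B) + 0))) (sym (cong toℕ gp))
          (s≤s (+-mono-≤ (leaf-positive apA A≢q) (+-mono-≤ (leaf-positive apB B≢q) z≤n)))
    where
    leaf-positive : ∀ {x} → a p x ≡ true → x ≢ q → 1 ≤ toℕ (g x)
    leaf-positive apx x≢q = n≢0⇒n>0 (pendant-positive _ trdf (deleted-double-star-leaf ds apx x≢q)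
                                       λ gp≡2 → contradiction (trans (sym (cong toℕ gp)) gp≡2) λ ())
  ... | suc (suc zero)
    with e , a′pe , ge≢0 ← proj₂ trdf p (λ gp≡0 → contradiction (trans (sym (cong toℕ gp)) gp≡0) λ ()) =
    (p ∷ e ∷ []) , ((adj-irrefl G (deleteEdge-⊆ a a′pe) ∷ []) ∷ [] ∷ []) ,
    (inj₁ refl ∷ inj₂ (deleteEdge-⊆ a a′pe , deleteEdge-removes a a′pe) ∷ []) ,
    subst (λ t → 3 ≤ t + (toℕ (g e) + 0)) (sym (cong toℕ gp)) (s≤s (s≤s (+-mono-≤ (n≢0⇒n>0 ge≢0) z≤n)))

  deleted-double-star-weight≥6 : {p q : Fin n} {g : Labelling n} → DoubleStarOn G p q →
                                 IsTRDF (deleteEdge a p q) g → 6 ≤ weight g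
  deleted-double-star-weight≥6 {p} {q} {g} ds trdf
    with L₁ , unique₁ , side₁ , weight₁ ← side-weight≥3 ds trdf
       | L₂ , unique₂ , side₂ , weight₂ ← side-weight≥3 (double-star-swap G ds)
                                            (IsTRDF-cong (deleteEdge-comm a p q) (λ _ → refl) trdf) = begin
    6                                  ≤⟨ +-mono-≤ weight₁ weight₂ ⟩
    sum (map h L₁) + sum (map h L₂)    ≡⟨ sum-++ (map h L₁) (map h L₂) ⟨
    sum (map h L₁ ++ map h L₂)         ≡⟨ cong sum (map-++ h L₁ L₂) ⟨
    sum (map h (L₁ ++ L₂))             ≤⟨ sum-unique≤∑ h (Unique.++⁺ unique₁ unique₂ disjoint) ⟩
    ∑ h                                ≡⟨ weight≡∑ g ⟨
    weight g                           ∎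
    where
    open ℕ.≤-Reasoning
    h : Fin n → ℕ
    h = toℕ ∘ g
    disjoint : ∀ {x} → ¬ (x Membership.∈ L₁ × x Membership.∈ L₂)
    disjoint (x∈L₁ , x∈L₂) = sides-disjoint ds (lookup side₁ x∈L₁) (lookup side₂ x∈L₂)

  centred : Fin n → Fin n → Labelling n
  centred p q = (const zero [ p ≔ two ]) [ q ≔ two ]

  centred-weight : {p q : Fin n} → p ≢ q → weight (centred p q) ≡ 4
  centred-weight {p} {q} p≢q = begin
    weight (centred p q)                 ≡⟨ weight-≔-from-zero (const zero [ p ≔ two ]) {q} zero-at-q ⟩
    weight (const zero [ p ≔ two ]) + 2  ≡⟨ cong (_+ 2) (weight-≔-from-zero (const zero) {p} refl) ⟩
    weight {n} (const zero) + 2 + 2      ≡⟨ cong (λ w → w + 2 + 2) (weight-zero {n}) ⟩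
    4                                    ∎
    where
    open ≡-Reasoning
    zero-at-q : toℕ ((const zero [ p ≔ two ]) q) ≡ 0
    zero-at-q = cong toℕ (≔-elsewhere (const zero) (p≢q ∘ sym))

  centred-trdf : {p q : Fin n} → DoubleStarOn G p q → IsTRDF a (centred p q)
  centred-trdf {p} {q} (p≢q , apq , attached , _) = dominated , supported
    where
    at-p : toℕ (centred p q p) ≡ 2
    at-p = cong toℕ (trans (≔-elsewhere _ p≢q) (≔-here (const zero) p two))
    at-q : toℕ (centred p q q) ≡ 2
    at-q = cong toℕ (≔-here _ q two)
    dominated : ∀ x → toℕ (centred p q x) ≡ 0 → ∃[ y ] (a x y ≡ true × toℕ (centred p q y) ≡ 2)
    dominated x cx≡0 with endpoint-or-away {u = p} {q} x
    ... | inj₁ refl          = contradiction (trans (sym at-p) cx≡0) λ ()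
    ... | inj₂ (inj₁ refl)   = contradiction (trans (sym at-q) cx≡0) λ ()
    ... | inj₂ (inj₂ (x≢p , x≢q)) with attached x x≢p x≢q
    ...   | inj₁ (apx , _) = p , adj-sym G apx , at-p
    ...   | inj₂ (_ , aqx) = q , adj-sym G aqx , at-q
    supported : ∀ x → toℕ (centred p q x) ≢ 0 → ∃[ y ] (a x y ≡ true × toℕ (centred p q y) ≢ 0)
    supported x cx≢0 with endpoint-or-away {u = p} {q} x
    ... | inj₁ refl          = q , apq , λ cq≡0 → contradiction (trans (sym at-q) cq≡0) λ ()
    ... | inj₂ (inj₁ refl)   = p , adj-sym G apq , λ cp≡0 → contradiction (trans (sym at-p) cp≡0) λ ()
    ... | inj₂ (inj₂ (x≢p , x≢q)) =
      contradiction (cong toℕ (trans (≔-elsewhere _ x≢q) (≔-elsewhere (const zero) x≢p))) cx≢0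

  double-star-centre-edge-bound : {p q : Fin n} {k : ℕ} {g : Labelling n} → DoubleStarOn G p q →
                                  IsGammaTR a k → IsTRDF (deleteEdge a p q) g → k + 2 ≤ weight g
  double-star-centre-edge-bound {k = k} ds@(p≢q , _) (_ , minimal) trdf =
    ≤-trans (+-monoˡ-≤ 2 (subst (k ≤_) (centred-weight p≢q) (minimal _ (centred-trdf ds))))
            (deleted-double-star-weight≥6 ds trdf)

  double-star⇒supercritical : {p q : Fin n} → DoubleStarOn G p q → ERSupercritical a
  double-star⇒supercritical ds u v auv deg-u deg-v k γ g trdf
    with double-star-inner-vertex G ds deg-u | double-star-inner-vertex G ds deg-v
  ... | inj₁ refl | inj₂ refl = double-star-centre-edge-bound ds γ trdf
  ... | inj₂ refl | inj₁ refl = double-star-centre-edge-bound (double-star-swap G ds) γ trdf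
  ... | inj₁ refl | inj₁ refl = contradiction refl (adj-irrefl G auv)
  ... | inj₂ refl | inj₂ refl = contradiction refl (adj-irrefl G auv)

-- A supercritical graph with an inner edge is a double star

-- f is a γtR-function of G. Each refutation below relabels f into a TRDF of G − uv, for an
-- inner edge uv, of weight at most γtR + 1, which no-cheap-repair rules out.
module Supercritical (G : Graph n) (supercritical : ERSupercritical (adj G)) {k : ℕ} (γ : IsGammaTR (adj G) k) where
  private
    a = adj G

  f : Labelling n
  f = proj₁ (proj₁ γ)

  f-trdf : IsTRDF a f
  f-trdf = proj₁ (proj₂ (proj₁ γ))

  f-weight : weight f ≡ k
  f-weight = proj₂ (proj₂ (proj₁ γ))

  F : Fin n → ℕ
  F = toℕ ∘ f

  no-cheap-repair : {u v : Fin n} {g : Labelling n} → InnerEdge a u v →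
                    IsTRDF (deleteEdge a u v) g → weight g ≤ k + 1 → ⊥
  no-cheap-repair (auv , deg-u , deg-v) trdf light =
    contradiction (+-cancelˡ-≤ k 2 1 (≤-trans (supercritical _ _ auv deg-u deg-v k γ _ trdf) light)) λ { (s≤s ()) }

  f-survives⇒⊥ : {u v : Fin n} → InnerEdge a u v → SatisfiedWithout a f u v → SatisfiedWithout a f v u → ⊥
  f-survives⇒⊥ e at-u at-v =
    no-cheap-repair e (trdf-deleteEdge f-trdf at-u at-v) (≤-trans (≤-reflexive f-weight) (ℕ.m≤m+n k 1))

  zero-endpoint-two-neighbour⇒⊥ : {x y w : Fin n} → InnerEdge a x y → F x ≡ 0 →
                                  a x w ≡ true → w ≢ y → F w ≡ 2 → ⊥
  zero-endpoint-two-neighbour⇒⊥ e fx≡0 axw w≢y fw≡2 =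
    f-survives⇒⊥ e (satisfied-zero a fx≡0 (_ , axw , w≢y , fw≡2)) (satisfied-beside-zero f-trdf fx≡0)

  zero-endpoint-dominated-across : {x y : Fin n} → InnerEdge a x y → F x ≡ 0 → F y ≡ 2
  zero-endpoint-dominated-across {x} {y} e fx≡0 with w , axw , fw≡2 ← proj₁ f-trdf x fx≡0 | w ≟ y
  ... | yes refl = fw≡2
  ... | no w≢y   = ⊥-elim (zero-endpoint-two-neighbour⇒⊥ e fx≡0 axw w≢y fw≡2)

  zero-endpoint-one-neighbour⇒⊥ : {x y w : Fin n} → InnerEdge a x y → F x ≡ 0 →
                                  a x w ≡ true → w ≢ y → F w ≡ 1 → ⊥
  zero-endpoint-one-neighbour⇒⊥ {x} {y} {w} e fx≡0 axw w≢y fw≡1 =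
    no-cheap-repair e (trdf-deleteEdge g-trdf at-x (satisfied-beside-zero g-trdf gx≡0)) light
    where
    g : Labelling n
    g = f [ w ≔ two ]
    g-trdf : IsTRDF a g
    g-trdf = ≔-preserves-TRDF f-trdf (λ ()) (λ fw≡0 → contradiction (trans (sym fw≡0) fw≡1) λ ())
                                          (λ _ 2≢2 → contradiction refl 2≢2)
    gx≡0 : toℕ (g x) ≡ 0
    gx≡0 = trans (cong toℕ (≔-elsewhere f λ { refl → contradiction (trans (sym fx≡0) fw≡1) λ () })) fx≡0
    at-x : SatisfiedWithout a g x y
    at-x = satisfied-zero a gx≡0 (w , axw , w≢y , cong toℕ (≔-here f w two))
    light : weight g ≤ k + 1
    light = ≤-reflexive (+-cancelʳ-≡ 1 _ _ (begin
      weight g + 1      ≡⟨ cong (weight g +_) fw≡1 ⟨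
      weight g + F w    ≡⟨ weight-≔ f w two ⟩
      weight f + 2      ≡⟨ cong (_+ 2) f-weight ⟩
      k + 2             ≡⟨ +-assoc k 1 1 ⟨
      k + 1 + 1         ∎))
      where open ≡-Reasoning

  -- A neighbour w ≠ y of a vertex x labelled 0 cannot carry 2 (f survives), nor 1 (raise it to
  -- 2), nor 0 (then xw is an inner edge, so w carries 2).
  inner-endpoint-positive : {x y : Fin n} → InnerEdge a x y → F x ≢ 0
  inner-endpoint-positive {x} {y} e@(_ , deg-x , _) fx≡0
    with w , axw , w≢y ← other-neighbour a deg-x y | f w in fw
  ... | suc (suc zero) = zero-endpoint-two-neighbour⇒⊥ e fx≡0 axw w≢y (cong toℕ fw)
  ... | suc zero       = zero-endpoint-one-neighbour⇒⊥ e fx≡0 axw w≢y (cong toℕ fw)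
  ... | zero with z , awz , fz≡2 ← proj₁ f-trdf w (cong toℕ fw) =
    contradiction (trans (sym (cong toℕ fw)) (zero-endpoint-dominated-across (axw , deg-x , deg-w) fx≡0)) λ ()
    where
    deg-w : 2 ≤ deg a w
    deg-w = two-neighbours⇒deg≥2 a (adj-sym G axw) awz λ { refl → contradiction (trans (sym fx≡0) fz≡2) λ () }

  Backed : Fin n → Fin n → Set
  Backed u v = ∃[ w ] (a u w ≡ true × w ≢ v × F w ≢ 0)

  Backed? : ∀ u v → Dec (Backed u v)
  Backed? u v = any? λ w → (a u w Bool.≟ true) ×-dec ¬? (w ≟ v) ×-dec ¬? (F w ℕ.≟ 0)

  both-backed⇒⊥ : {u v : Fin n} → InnerEdge a u v → Backed u v → Backed v u → ⊥
  both-backed⇒⊥ e backed-u backed-v =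
    f-survives⇒⊥ e (satisfied-positive a (inner-endpoint-positive e) backed-u)
                   (satisfied-positive a (inner-endpoint-positive (inner-edge-sym G e)) backed-v)

  -- Raise a neighbour w ≠ v of u from 0 to 1; u and w then support each other.
  one-sided-backing⇒⊥ : {u v : Fin n} → InnerEdge a u v → ¬ Backed u v → Backed v u → ⊥
  one-sided-backing⇒⊥ {u} {v} e@(_ , deg-u , _) unbacked (x , avx , x≢u , fx≢0)
    with w , auw , w≢v ← other-neighbour a deg-u v =
    no-cheap-repair e (trdf-deleteEdge g-trdf at-u at-v) light
    where
    fw≡0 : F w ≡ 0
    fw≡0 = Dec.decidable-stable (F w ℕ.≟ 0) λ fw≢0 → unbacked (w , auw , w≢v , fw≢0)
    g : Labelling n
    g = f [ w ≔ one ]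
    g-trdf : IsTRDF a g
    g-trdf = ≔-preserves-TRDF f-trdf (λ ()) (λ _ → u , adj-sym G auw , inner-endpoint-positive e)
                                  (λ fw≡2 → contradiction (trans (sym fw≡0) fw≡2) λ ())
    at-u : SatisfiedWithout a g u v
    at-u = satisfied-positive a (≔-positive f (λ ()) (inner-endpoint-positive e))
                              (w , auw , w≢v , ≔-here-positive f λ ())
    at-v : SatisfiedWithout a g v u
    at-v = satisfied-positive a (≔-positive f (λ ()) (inner-endpoint-positive (inner-edge-sym G e)))
                              (x , avx , x≢u , ≔-positive f (λ ()) fx≢0)
    light : weight g ≤ k + 1
    light = ≤-reflexive (trans (weight-≔-from-zero f fw≡0) (cong (_+ 1) f-weight))

  inner-endpoint-unbacked : {u v : Fin n} → InnerEdge a u v → ¬ Backed u v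
  inner-endpoint-unbacked {u} {v} e backed-u with Backed? v u
  ... | yes backed-v = both-backed⇒⊥ e backed-u backed-v
  ... | no unbacked-v = one-sided-backing⇒⊥ (inner-edge-sym G e) unbacked-v backed-u

  private-neighbour-zero : {u v w : Fin n} → InnerEdge a u v → a u w ≡ true → w ≢ v → F w ≡ 0
  private-neighbour-zero {w = w} e auw w≢v =
    Dec.decidable-stable (F w ℕ.≟ 0) λ fw≢0 → inner-endpoint-unbacked e (w , auw , w≢v , fw≢0)

  private-neighbour-pendant : {u v : Fin n} → InnerEdge a u v → ∀ w → a u w ≡ true → w ≢ v → Pendant a w u
  private-neighbour-pendant {u} e@(_ , deg-u , _) w auw w≢v z awz with z ≟ u
  ... | yes z≡u = z≡u
  ... | no z≢u  = contradiction (private-neighbour-zero e auw w≢v) (inner-endpoint-positive (awu , deg-w , deg-u))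
    where
    awu   = adj-sym G auw
    deg-w = two-neighbours⇒deg≥2 a awu awz (z≢u ∘ sym)

  inner-endpoint-two : {u v : Fin n} → InnerEdge a u v → F u ≡ 2
  inner-endpoint-two {u} {v} e@(_ , deg-u , _)
    with l , aul , l≢v ← other-neighbour a deg-u v
    with z , alz , fz≡2 ← proj₁ f-trdf l (private-neighbour-zero e aul l≢v) =
    subst (λ z → F z ≡ 2) (private-neighbour-pendant e l aul l≢v z alz) fz≡2

  -- If deg u = 2, relabel to 1 the vertex u (label 2), its leaf l and a leaf m of v (labels 0).
  module DegreeTwo {u v l m : Fin n} (e : InnerEdge a u v) (aul : a u l ≡ true) (l≢v : l ≢ v)
                   (avm : a v m ≡ true) (m≢u : m ≢ u) (u-neighbours : ∀ {z} → a u z ≡ true → z ≡ v ⊎ z ≡ l) where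

    f₁ f₂ g : Labelling n
    f₁ = f [ l ≔ one ]
    f₂ = f₁ [ m ≔ one ]
    g  = f₂ [ u ≔ one ]

    fu≡2 : F u ≡ 2
    fu≡2 = inner-endpoint-two e

    fv≢0 : F v ≢ 0
    fv≢0 = inner-endpoint-positive (inner-edge-sym G e)

    fl≡0 : F l ≡ 0
    fl≡0 = private-neighbour-zero e aul l≢v

    l≢m : l ≢ m
    l≢m refl = adj-irrefl G (proj₁ e) (sym (private-neighbour-pendant e l aul l≢v v (adj-sym G avm)))

    f₁m≡0 : toℕ (f₁ m) ≡ 0
    f₁m≡0 = trans (cong toℕ (≔-elsewhere f (l≢m ∘ sym))) (private-neighbour-zero (inner-edge-sym G e) avm m≢u)

    f₂u≡2 : toℕ (f₂ u) ≡ 2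
    f₂u≡2 = trans (cong toℕ (trans (≔-elsewhere f₁ (m≢u ∘ sym)) (≔-elsewhere f (adj-irrefl G aul)))) fu≡2

    f₂v≢0 : toℕ (f₂ v) ≢ 0
    f₂v≢0 = ≔-positive f₁ (λ ()) (≔-positive f (λ ()) fv≢0)

    f₂l≢0 : toℕ (f₂ l) ≢ 0
    f₂l≢0 = ≔-positive f₁ (λ ()) (≔-here-positive f (λ ()))

    g-trdf : IsTRDF a g
    g-trdf = ≔-preserves-TRDF f₂-trdf (λ ())
               (λ f₂u≡0 → contradiction (trans (sym f₂u≡2) f₂u≡0) λ ())
               (λ _ _ z azu → [ (λ { refl → f₂v≢0 }) , (λ { refl → f₂l≢0 }) ]′ (u-neighbours (adj-sym G azu)))
      where
      f₁-trdf : IsTRDF a f₁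
      f₁-trdf = ≔-preserves-TRDF f-trdf (λ ())
                  (λ _ → u , adj-sym G aul , λ fu≡0 → contradiction (trans (sym fu≡2) fu≡0) λ ())
                  (λ fl≡2 → contradiction (trans (sym fl≡0) fl≡2) λ ())
      f₂-trdf : IsTRDF a f₂
      f₂-trdf = ≔-preserves-TRDF f₁-trdf (λ ())
                  (λ _ → v , adj-sym G avm , ≔-positive f (λ ()) fv≢0)
                  (λ f₁m≡2 → contradiction (trans (sym f₁m≡0) f₁m≡2) λ ())

    g-at-u : SatisfiedWithout a g u v
    g-at-u = satisfied-positive a (≔-here-positive f₂ (λ ())) (l , aul , l≢v , ≔-positive f₂ (λ ()) f₂l≢0)

    g-at-v : SatisfiedWithout a g v u
    g-at-v = satisfied-positive a (≔-positive f₂ (λ ()) f₂v≢0)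
                                (m , avm , m≢u , ≔-positive f₂ (λ ()) (≔-here-positive f₁ (λ ())))

    g-light : weight g ≤ k + 1
    g-light = ≤-reflexive (+-cancelʳ-≡ 2 _ _ (begin
      weight g + 2            ≡⟨ cong (weight g +_) f₂u≡2 ⟨
      weight g + toℕ (f₂ u)   ≡⟨ weight-≔ f₂ u one ⟩
      weight f₂ + 1           ≡⟨ cong (_+ 1) (weight-≔-from-zero f₁ f₁m≡0) ⟩
      weight f₁ + 1 + 1       ≡⟨ cong (λ w → w + 1 + 1) (weight-≔-from-zero f fl≡0) ⟩
      weight f + 1 + 1 + 1    ≡⟨ cong (λ w → w + 1 + 1 + 1) f-weight ⟩
      k + 1 + 1 + 1           ≡⟨ +-assoc (k + 1) 1 1 ⟩
      k + 1 + 2               ∎))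
      where open ≡-Reasoning

  inner-endpoint-deg≥3 : {u v : Fin n} → InnerEdge a u v → 3 ≤ deg a u
  inner-endpoint-deg≥3 {u} {v} e@(auv , deg-u , deg-v) with 3 ≤? deg a u
  ... | yes deg-u≥3 = deg-u≥3
  ... | no deg-u<3
    with l , aul , l≢v ← other-neighbour a deg-u v
       | m , avm , m≢u ← other-neighbour a deg-v u =
    ⊥-elim (no-cheap-repair e (trdf-deleteEdge g-trdf g-at-u g-at-v) g-light)
    where
    u-neighbours : ∀ {z} → a u z ≡ true → z ≡ v ⊎ z ≡ l
    u-neighbours {z} auz with z ≟ v | z ≟ l
    ... | yes z≡v | _       = inj₁ z≡v
    ... | no _    | yes z≡l = inj₂ z≡l
    ... | no z≢v  | no z≢l  =
      contradiction (three-neighbours⇒deg≥3 a auv aul auz (l≢v ∘ sym) (z≢v ∘ sym) (z≢l ∘ sym)) deg-u<3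
    open DegreeTwo e aul l≢v avm m≢u u-neighbours

  inner-edge⇒double-star : Connected a → {u v : Fin n} → InnerEdge a u v → DoubleStarOn G u v
  inner-edge⇒double-star conn e@(auv , _) =
    let attached , no-other-edge = double-star-shape G conn auv (private-neighbour-pendant e)
                                                      (private-neighbour-pendant (inner-edge-sym G e))
    in adj-irrefl G auv , auv , attached , no-other-edge ,
       inner-endpoint-deg≥3 e , inner-endpoint-deg≥3 (inner-edge-sym G e)

inner-edge? : (a : Adj n) → Dec (∃₂ (InnerEdge a))
inner-edge? a = any? λ u → any? λ v → (a u v Bool.≟ true) ×-dec (2 ≤? deg a u) ×-dec (2 ≤? deg a v)

supercritical⇒star-or-double-star : (G : Graph n) → Connected (adj G) → NoIsolated (adj G) → Fin n →
                                    ERSupercritical (adj G) → IsStar (adj G) ⊎ IsDoubleStar3 (adj G)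
supercritical⇒star-or-double-star G conn no-isolated x supercritical with inner-edge? (adj G)
... | yes (u , v , e) = inj₂ (u , v , inner-edge⇒double-star conn e)
  where open Supercritical G supercritical (proj₂ (γtR-exists (adj G) no-isolated))
... | no no-inner     = inj₁ (no-inner-edge⇒star G conn (proj₂ (no-isolated x)) λ u v e → no-inner (u , v , e))

theorem8p1 : ∀ (n : ℕ) (G : Graph n) → 0 < n → Connected (adj G) → NoIsolated (adj G) →
    (ERSupercritical (adj G) ⇔ (IsStar (adj G) ⊎ IsDoubleStar3 (adj G)))
theorem8p1 n G 0<n conn no-isolated =
  mk⇔ (supercritical⇒star-or-double-star G conn no-isolated (fromℕ< 0<n))
      [ star⇒supercritical G , (λ (_ , _ , double-star) → double-star⇒supercritical G double-star) ]′
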